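{- Let $j\geq m\geq 3$ and $n\geq 2$ be integers such that $m-1$ divides $j$. Then \[ m_j(K_m,K_{1,n})=\Big\lfloor \frac{n-1}{\frac{j}{m-1}-1}\Big\rfloor+1 . \]
   Context: All graphs are simple; $K_m$ is the complete graph on $m$ vertices and $K_{1,n}$ is the star with $n+1$ vertices ($n$ leaves). For integers $j\geq 2$ and $t\geq 1$, $K_{j\times t}$ denotes the complete multipartite graph with $j$ parts, each of size $t$. For graphs $H$ and $G$, the size multipartite Ramsey number $m_j(H,G)$ is the smallest natural number $t$ such that every coloring of the edges of $K_{j\times t}$ with two colors red and blue contains a red copy of $H$ or a blue copy of $G$ as a subgraph. -}

module Defs where

open import Data.Nat using (ℕ; zero; suc; _≤_)
open import Data.Nat.DivMod using (_/_)
open import Data.Fin using (Fin)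
open import Data.Bool using (Bool; true; false)
open import Data.Product using (_×_; Σ; proj₁; ∃)
open import Data.Sum using (_⊎_)
open import Function.Definitions using (Injective)
open import Relation.Binary.PropositionalEquality using (_≡_; _≢_)

-- Vertices of the complete multipartite graph K_{j×t}: (part, index in part).
Vertex : ℕ → ℕ → Set
Vertex j t = Fin j × Fin t

Adj : {j t : ℕ} → Vertex j t → Vertex j t → Set
Adj u v = proj₁ u ≢ proj₁ v

red blue : Bool
red = true
blue = false

-- A 2-colouring of the edges of K_{j×t}: a symmetric colour assignment to pairs
-- (the values on non-edges are irrelevant).
record Colouring (j t : ℕ) : Set where
  field
    col : Vertex j t → Vertex j t → Bool
    sym : ∀ u v → col u v ≡ col v u
open Colouring public

RedClique : {j t : ℕ} → Colouring j t → ℕ → Set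
RedClique {j} {t} c m =
  Σ (Fin m → Vertex j t) λ f →
    Injective _≡_ _≡_ f ×
    (∀ a b → a ≢ b → Adj (f a) (f b) × col c (f a) (f b) ≡ red)

-- A blue copy of K_{1,n}: a centre and n distinct leaves, each adjacent to the
-- centre by a blue edge (leaves differ from the centre since they are adjacent to it).
BlueStar : {j t : ℕ} → Colouring j t → ℕ → Set
BlueStar {j} {t} c n =
  Σ (Vertex j t) λ v → Σ (Fin n → Vertex j t) λ g →
    Injective _≡_ _≡_ g ×
    (∀ i → Adj v (g i) × col c v (g i) ≡ blue)

Arrows : ℕ → ℕ → ℕ → ℕ → Set
Arrows j t m n = (c : Colouring j t) → RedClique c m ⊎ BlueStar c n

SizeMultipartiteRamsey≡ : ℕ → ℕ → ℕ → ℕ → Set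
SizeMultipartiteRamsey≡ j m n r =
  Arrows j r m n × (∀ t → Arrows j t m n → r ≤ t)

-- Floor division with the convention a div 0 = 0 (only used with nonzero divisors).
_div_ : ℕ → ℕ → ℕ
a div zero = zero
a div suc b = a / suc b

{-# OPTIONS --safe #-}
module Submission where

-- Write j = (p + 1)(m − 1) and n = n′ + 1. Splitting the j parts into m − 1 groups of p + 1
-- parts and colouring an edge blue exactly when its ends lie in the same group gives no red K_m
-- (pigeonhole on the groups) and blue degree p t everywhere, so t is too small whenever
-- p t ≤ n′. Conversely, if no vertex has n′ + 1 blue neighbours, every vertex has at most
-- t + n′ non-red neighbours (its own part included), so greedily picking m vertices, each a
-- common red neighbour of the earlier ones, succeeds as long as (m − 1)(t + n′) < j t, that is
-- n′ < p t, which holds for t = ⌊n′ / p⌋ + 1.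

open import Defs
open import Data.Bool as Bool using (not)
open import Data.Fin
  using (Fin; zero; suc; combine; remQuot; quotient; remainder; punchOut; inject≤)
open import Data.Fin.Properties
  using (_≟_; <⇒≢; remQuot-combine; combine-remQuot; combine-injective; punchOut-injective;
         inject≤-injective; injective⇒≤; pigeonhole; ¬∀⟶∃¬)
open import Data.List using (List; []; _∷_; _++_; length; lookup; tabulate; filter)
open import Data.List.Membership.Propositional using (_∈_; _∉_; lose)
open import Data.List.Membership.Propositional.Properties
  using (∈-lookup; ∈-tabulate⁺; ∈-filter⁺; ∈-filter⁻; ∈-++⁺ˡ; ∈-++⁺ʳ)
open import Data.List.Membership.Setoid.Properties using (index-injective)
open import Data.List.Properties using (length-tabulate; length-++)
open import Data.List.Relation.Unary.Any using (satisfied; any?)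
open import Data.List.Relation.Unary.AllPairs using (_∷_)
open import Data.List.Relation.Unary.Unique.Propositional using (Unique)
open import Data.List.Relation.Unary.Unique.Propositional.Properties
  using (tabulate⁺; filter⁺; Unique[x∷xs]⇒x∉xs)
open import Data.Nat
  using (ℕ; zero; suc; _+_; _*_; _∸_; _≤_; _<_; z≤n; s≤s; NonZero; _≤?_)
open import Data.Nat.Divisibility using (_∣_; divides)
open import Data.Nat.DivMod using (_/_; _%_; m≡m%n+[m/n]*n; m%n<n; m*n/n≡m; m<n*o⇒m/o<n)
open import Data.Nat.Properties
  using (≤-trans; ≤-reflexive; ≤-<-trans; <⇒≱; ≰⇒>; ≮⇒≥; n≮n; n<1+n; n≤1+n;
         m<1+n⇒m≤n; +-comm; *-comm; *-assoc; *-suc; *-identityˡ; +-mono-≤;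
         +-monoˡ-<; +-monoʳ-<; *-monoˡ-≤; *-monoʳ-<; module ≤-Reasoning)
open import Data.Product using (Σ; ∃; _×_; _,_; proj₁; proj₂; uncurry)
open import Data.Product.Properties using (≡-dec)
open import Data.Sum using (inj₁; inj₂; [_,_])
import Data.Vec.Functional as Vector
open import Function using (_∘_)
open import Function.Definitions using (Injective)
open import Relation.Binary.Definitions using (DecidableEquality)
open import Relation.Binary.PropositionalEquality
  using (_≡_; _≢_; refl; trans; cong; cong₂; subst; setoid; module ≡-Reasoning)
  renaming (sym to ≡-sym)
open import Relation.Nullary using (¬_; yes; no; does; contradiction)
open import Relation.Nullary.Decidable using (¬?; _×-dec_; dec-true; dec-false)
open import Relation.Unary using (Decidable)

module _ {A : Set} where

  lookup-injective : {xs : List A} → Unique xs → Injective _≡_ _≡_ (lookup xs)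
  lookup-injective {_ ∷ _}  _       {zero}  {zero}  _  = refl
  lookup-injective {_ ∷ xs} u       {zero}  {suc j} eq =
    contradiction (subst (_∈ xs) (≡-sym eq) (∈-lookup j)) (Unique[x∷xs]⇒x∉xs u)
  lookup-injective {_ ∷ xs} u       {suc i} {zero}  eq =
    contradiction (subst (_∈ xs) eq (∈-lookup i)) (Unique[x∷xs]⇒x∉xs u)
  lookup-injective         (_ ∷ u)  {suc i} {suc j} eq = cong suc (lookup-injective u eq)

  distinctMembers : ∀ {n} {xs : List A} → Unique xs → n ≤ length xs →
                    Σ (Fin n → A) λ g → Injective _≡_ _≡_ g × (∀ i → g i ∈ xs)
  distinctMembers {xs = xs} u n≤ =
    (λ i → lookup xs (inject≤ i n≤)) ,
    (λ eq → inject≤-injective n≤ n≤ _ _ (lookup-injective u eq)) ,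
    (λ i → ∈-lookup (inject≤ i n≤))

  length<⇒∃∉ : DecidableEquality A → ∀ {xs ys : List A} → Unique ys →
               length xs < length ys → ∃ λ y → y ∉ xs
  length<⇒∃∉ _≟ᴬ_ {xs} {ys} u xs<ys =
    let i , lookup∉ = ¬∀⟶∃¬ (length ys) _ (λ i → lookup ys i ∈? xs) notCovered
    in  lookup ys i , lookup∉
    where
    open import Data.List.Membership.DecPropositional _≟ᴬ_ using (_∈?_)
    notCovered : ¬ (∀ i → lookup ys i ∈ xs)
    notCovered covered = <⇒≱ xs<ys (injective⇒≤ λ eq →
      lookup-injective u (index-injective (setoid A) (covered _) (covered _) eq))

remQuot-injective : ∀ {m} n → Injective _≡_ _≡_ (remQuot {m} n)
remQuot-injective {m} n {x} {y} eq = begin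
  x                                  ≡⟨ combine-remQuot {m} n x ⟨
  uncurry combine (remQuot {m} n x)  ≡⟨ cong (uncurry combine) eq ⟩
  uncurry combine (remQuot {m} n y)  ≡⟨ combine-remQuot {m} n y ⟩
  y                                  ∎
  where open ≡-Reasoning

module _ {j t : ℕ} where

  vertices : List (Vertex j t)
  vertices = tabulate (remQuot {j} t)

  vertices-unique : Unique vertices
  vertices-unique = tabulate⁺ (remQuot-injective {j} t)

  ∈-vertices : ∀ v → v ∈ vertices
  ∈-vertices (a , x) = subst (_∈ vertices) (remQuot-combine a x) (∈-tabulate⁺ (combine a x))

  length-vertices : length vertices ≡ j * t
  length-vertices = length-tabulate (remQuot {j} t)

  _≟ᵛ_ : DecidableEquality (Vertex j t)
  _≟ᵛ_ = ≡-dec _≟_ _≟_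

  partMates : Vertex j t → List (Vertex j t)
  partMates (a , _) = tabulate (a ,_)

  length-partMates : ∀ u → length (partMates u) ≡ t
  length-partMates (a , _) = length-tabulate (a ,_)

module _ {j t : ℕ} (c : Colouring j t) where

  RedEdge BlueEdge : Vertex j t → Vertex j t → Set
  RedEdge  u v = Adj u v × col c u v ≡ red
  BlueEdge u v = Adj u v × col c u v ≡ blue

  RedEdge-sym : ∀ {u v} → RedEdge u v → RedEdge v u
  RedEdge-sym {u} {v} (u≁v , isRed) = u≁v ∘ ≡-sym , trans (sym c v u) isRed

  pairwiseRed⇒RedClique : ∀ {m} (f : Fin m → Vertex j t) →
                          (∀ a b → a ≢ b → RedEdge (f a) (f b)) → RedClique c m
  pairwiseRed⇒RedClique f allRed = f , injective , allRed
    where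
    injective : Injective _≡_ _≡_ f
    injective {a} {b} eq with a ≟ b
    ... | yes a≡b = a≡b
    ... | no  a≢b = contradiction (cong proj₁ eq) (proj₁ (allRed a b a≢b))

  blueEdge? : ∀ u → Decidable (BlueEdge u)
  blueEdge? u v = ¬? (proj₁ u ≟ proj₁ v) ×-dec (col c u v Bool.≟ blue)

  blueNeighbours : Vertex j t → List (Vertex j t)
  blueNeighbours u = filter (blueEdge? u) vertices

  blueNeighbours-unique : ∀ u → Unique (blueNeighbours u)
  blueNeighbours-unique u = filter⁺ (blueEdge? u) (vertices-unique {j} {t})

  blueStar : ∀ {n} u → n ≤ length (blueNeighbours u) → BlueStar c n
  blueStar u n≤ with g , g-injective , g∈ ← distinctMembers (blueNeighbours-unique u) n≤ =
    u , g , g-injective , λ i → proj₂ (∈-filter⁻ (blueEdge? u) {xs = vertices} (g∈ i))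

  nonRedNeighbours : Vertex j t → List (Vertex j t)
  nonRedNeighbours u = partMates u ++ blueNeighbours u

  ∉nonRedNeighbours⇒RedEdge : ∀ u v → v ∉ nonRedNeighbours u → RedEdge u v
  ∉nonRedNeighbours⇒RedEdge u@(a , _) v@(b , y) v∉ with a ≟ b | col c u v in colour
  ... | yes refl | _          = contradiction (∈-++⁺ˡ (∈-tabulate⁺ y)) v∉
  ... | no  a≢b  | Bool.true  = a≢b , refl
  ... | no  a≢b  | Bool.false = contradiction (∈-++⁺ʳ (partMates u) v∈blue) v∉
    where
    v∈blue : v ∈ blueNeighbours u
    v∈blue = ∈-filter⁺ (blueEdge? u) (∈-vertices v) (a≢b , colour)

module Greedy {j t n : ℕ} (c : Colouring j t)
              (fewBlue : ∀ u → length (blueNeighbours c u) ≤ n) where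

  length-nonRedNeighbours : ∀ u → length (nonRedNeighbours c u) ≤ t + n
  length-nonRedNeighbours u = begin
    length (partMates u ++ blueNeighbours c u)
      ≡⟨ length-++ (partMates u) ⟩
    length (partMates u) + length (blueNeighbours c u)
      ≤⟨ +-mono-≤ (≤-reflexive (length-partMates u)) (fewBlue u) ⟩
    t + n
      ∎
    where open ≤-Reasoning

  record GreedyClique (i : ℕ) : Set where
    field
      vertex          : Fin i → Vertex j t
      pairwiseRed     : ∀ a b → a ≢ b → RedEdge c (vertex a) (vertex b)
      excluded        : List (Vertex j t)
      length-excluded : length excluded ≤ i * (t + n)
      commonRed       : ∀ v → v ∉ excluded → ∀ a → RedEdge c (vertex a) v

  empty : GreedyClique 0
  empty = record
    { vertex          = λ ()
    ; pairwiseRed     = λ ()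
    ; excluded        = []
    ; length-excluded = z≤n
    ; commonRed       = λ _ _ ()
    }

  vertexOutside : ∀ {i} → i * (t + n) < j * t → (K : GreedyClique i) →
                  ∃ λ w → w ∉ GreedyClique.excluded K
  vertexOutside {i} room K = length<⇒∃∉ _≟ᵛ_ (vertices-unique {j} {t}) (begin-strict
    length (GreedyClique.excluded K)  ≤⟨ GreedyClique.length-excluded K ⟩
    i * (t + n)                       <⟨ room ⟩
    j * t                             ≡⟨ length-vertices {j} {t} ⟨
    length (vertices {j} {t})         ∎)
    where open ≤-Reasoning

  extend : ∀ {i} → i * (t + n) < j * t → GreedyClique i → GreedyClique (suc i)
  extend room K with w , w∉ ← vertexOutside room K = record
    { vertex          = vertex′
    ; pairwiseRed     = pairwiseRed′
    ; excluded        = nonRedNeighbours c w ++ excluded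
    ; length-excluded = ≤-trans (≤-reflexive (length-++ (nonRedNeighbours c w)))
                                (+-mono-≤ (length-nonRedNeighbours w) length-excluded)
    ; commonRed       = commonRed′
    }
    where
    open GreedyClique K
    vertex′ : Fin (suc _) → Vertex j t
    vertex′ = w Vector.∷ vertex
    pairwiseRed′ : ∀ a b → a ≢ b → RedEdge c (vertex′ a) (vertex′ b)
    pairwiseRed′ zero    zero    0≢0 = contradiction refl 0≢0
    pairwiseRed′ zero    (suc b) _   = RedEdge-sym c (commonRed w w∉ b)
    pairwiseRed′ (suc a) zero    _   = commonRed w w∉ a
    pairwiseRed′ (suc a) (suc b) a≢b = pairwiseRed a b (a≢b ∘ cong suc)
    commonRed′ : ∀ v → v ∉ nonRedNeighbours c w ++ excluded →
                 ∀ a → RedEdge c (vertex′ a) v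
    commonRed′ v v∉ zero    = ∉nonRedNeighbours⇒RedEdge c w v (v∉ ∘ ∈-++⁺ˡ)
    commonRed′ v v∉ (suc a) = commonRed v (v∉ ∘ ∈-++⁺ʳ (nonRedNeighbours c w)) a

  greedyClique : ∀ d → d * (t + n) < j * t → GreedyClique (suc d)
  greedyClique zero    room = extend room empty
  greedyClique (suc d) room =
    extend room (greedyClique d (≤-<-trans (*-monoˡ-≤ (t + n) (n≤1+n d)) room))

  redClique : ∀ d → d * (t + n) < j * t → RedClique c (suc d)
  redClique d room = pairwiseRed⇒RedClique c vertex pairwiseRed
    where open GreedyClique (greedyClique d room)

d*[t+n]<j*t⇒Arrows : ∀ {j t d n} → d * (t + n) < j * t → Arrows j t (suc d) (suc n)
d*[t+n]<j*t⇒Arrows {d = d} {n} room c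
  with any? (λ u → suc n ≤? length (blueNeighbours c u)) vertices
... | yes manyBlue = inj₂ (blueStar c _ (proj₂ (satisfied manyBlue)))
... | no  ¬manyBlue = inj₁ (Greedy.redClique c fewBlue d room)
  where
  fewBlue : ∀ u → length (blueNeighbours c u) ≤ n
  fewBlue u = m<1+n⇒m≤n (≰⇒> (¬manyBlue ∘ lose (∈-vertices u)))

does-≟-sym : ∀ {n} (x y : Fin n) → does (x ≟ y) ≡ does (y ≟ x)
does-≟-sym x y with x ≟ y
... | yes x≡y = ≡-sym (dec-true (y ≟ x) (≡-sym x≡y))
... | no  x≢y = ≡-sym (dec-false (y ≟ x) (x≢y ∘ ≡-sym))

module GroupColouring (p d t : ℕ) where

  group : Fin (suc p * d) → Fin d
  group = remainder {suc p} d

  groupColouring : Colouring (suc p * d) t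
  groupColouring = record
    { col = λ u v → not (does (group (proj₁ u) ≟ group (proj₁ v)))
    ; sym = λ u v → cong not (does-≟-sym (group (proj₁ u)) (group (proj₁ v)))
    }

  sameGroup⇒blue : ∀ u v → group (proj₁ u) ≡ group (proj₁ v) →
                   col groupColouring u v ≡ blue
  sameGroup⇒blue u v same = cong not (dec-true (group (proj₁ u) ≟ group (proj₁ v)) same)

  blue⇒sameGroup : ∀ u v → col groupColouring u v ≡ blue →
                   group (proj₁ u) ≡ group (proj₁ v)
  blue⇒sameGroup u v isBlue with group (proj₁ u) ≟ group (proj₁ v)
  ... | yes same = same
  ... | no  _    = contradiction isBlue λ ()

  ¬redClique : ¬ RedClique groupColouring (suc d)
  ¬redClique (f , _ , allRed)
    with a , b , a<b , same ← pigeonhole (n<1+n d) (group ∘ proj₁ ∘ f) =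
    contradiction (trans (≡-sym isRed) (sameGroup⇒blue (f a) (f b) same)) λ ()
    where
    isRed : col groupColouring (f a) (f b) ≡ red
    isRed = proj₂ (allRed a b (<⇒≢ a<b))

  ¬blueStar : ∀ {n} → p * t < n → ¬ BlueStar groupColouring n
  ¬blueStar {n} pt<n (v , g , g-injective , blue) = <⇒≱ pt<n (injective⇒≤ φ-injective)
    where
    -- A leaf lies in one of the p parts of the centre's group other than the centre's own;
    -- φ records which one (through punchOut) together with the leaf's index in its part.
    sameGroup : ∀ i → group (proj₁ v) ≡ group (proj₁ (g i))
    sameGroup i = blue⇒sameGroup v (g i) (proj₂ (blue i))
    otherPosition : ∀ i → quotient d (proj₁ v) ≢ quotient d (proj₁ (g i))
    otherPosition i samePosition =
      proj₁ (blue i) (remQuot-injective d (cong₂ _,_ samePosition (sameGroup i)))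
    φ : Fin n → Fin (p * t)
    φ i = combine (punchOut (otherPosition i)) (proj₂ (g i))
    φ-injective : Injective _≡_ _≡_ φ
    φ-injective {i} {i′} eq with samePosition , sameIndex ← combine-injective _ _ _ _ eq =
      g-injective (cong₂ _,_ (remQuot-injective d (cong₂ _,_
        (punchOut-injective (otherPosition i) (otherPosition i′) samePosition)
        (trans (≡-sym (sameGroup i)) (sameGroup i′)))) sameIndex)

  p*t<n⇒¬Arrows : ∀ {n} → p * t < n → ¬ Arrows (suc p * d) t (suc d) n
  p*t<n⇒¬Arrows pt<n arrows = [ ¬redClique , ¬blueStar pt<n ] (arrows groupColouring)

n<p*[n/p+1] : ∀ n p .{{_ : NonZero p}} → n < p * (n / p + 1)
n<p*[n/p+1] n p = begin-strict
  n                     ≡⟨ m≡m%n+[m/n]*n n p ⟩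
  n % p + n / p * p     <⟨ +-monoˡ-< (n / p * p) (m%n<n n p) ⟩
  p + n / p * p         ≡⟨ cong (p +_) (*-comm (n / p) p) ⟩
  p + p * (n / p)       ≡⟨ *-suc p (n / p) ⟨
  p * suc (n / p)       ≡⟨ cong (p *_) (+-comm 1 (n / p)) ⟩
  p * (n / p + 1)       ∎
  where open ≤-Reasoning

sizeMultipartiteRamsey-clique-star : ∀ p d n .{{_ : NonZero p}} .{{_ : NonZero d}} →
  SizeMultipartiteRamsey≡ (suc p * d) (suc d) (suc n) (n / p + 1)
sizeMultipartiteRamsey-clique-star p d n = d*[t+n]<j*t⇒Arrows room , minimal
  where
  r : ℕ
  r = n / p + 1

  room : d * (r + n) < suc p * d * r
  room = begin-strict
    d * (r + n)       <⟨ *-monoʳ-< d (+-monoʳ-< r (n<p*[n/p+1] n p)) ⟩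
    d * (suc p * r)   ≡⟨ *-assoc d (suc p) r ⟨
    d * suc p * r     ≡⟨ cong (_* r) (*-comm d (suc p)) ⟩
    suc p * d * r     ∎
    where open ≤-Reasoning

  minimal : ∀ t → Arrows (suc p * d) t (suc d) (suc n) → r ≤ t
  minimal t arrows = begin
    n / p + 1   ≡⟨ +-comm (n / p) 1 ⟩
    suc (n / p) ≤⟨ m<n*o⇒m/o<n (subst (n <_) (*-comm p t) n<pt) ⟩
    t           ∎
    where
    open ≤-Reasoning
    n<pt : n < p * t
    n<pt = ≮⇒≥ λ pt<1+n → GroupColouring.p*t<n⇒¬Arrows p d t pt<1+n arrows

corollary2 : (j m n : ℕ) → 3 ≤ m → m ≤ j → 2 ≤ n → (m ∸ 1) ∣ j →
    SizeMultipartiteRamsey≡ j m n (((n ∸ 1) div ((j div (m ∸ 1)) ∸ 1)) + 1)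
corollary2 _ (suc (suc (suc m))) (suc (suc n)) (s≤s (s≤s (s≤s _))) m≤j (s≤s (s≤s _))
  (divides k refl) with k
... | 0 = contradiction m≤j λ ()
... | 1 = contradiction (subst (3 + m ≤_) (*-identityˡ (2 + m)) m≤j) (n≮n (2 + m))
... | suc (suc p) rewrite m*n/n≡m (2 + p) (2 + m) {{_}} =
  sizeMultipartiteRamsey-clique-star (suc p) (2 + m) (suc n)
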